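{- Let $X,Y$ be two nonempty disjoint subsets of a group $G$ with $X\cup Y=G$, and let $L$ be a subgroup of $G$ such that $X$ is a union of right cosets of $L$. Then $$(X\cdot Y^{ -1})\cup(Y\cdot X^{ -1})\subseteq G\setminus L. \qquad (*)$$ Moreover, the following are equivalent: (1) the inclusion $(*)$ is proper; (2) for each $y\in Y$ there exists $y'\in Y\setminus (Ly)$ with $y'y^{ -1}\cdot Y=Y$; (3) for some $y\in Y$ there exists $y'\in Y\setminus(Ly)$ with $y'y^{ -1}\cdot Y=Y$; (4) $Y$ is a union of right cosets of some subgroup of $G$ which properly contains $L$; (5) $X$ is a union of right cosets of some subgroup of $G$ which properly contains $L$. Further, the set $G\setminus\big((X\cdot Y^{ -1})\cup(Y\cdot X^{ -1})\big)$ is a subgroup of $G$, and it is the maximal subgroup of $G$ such that $Y$ is a union of its right cosets. Finally, if $Y$ is finite, then the inclusion $(X\cdot Y^{ -1})\cup(Y\cdot X^{ -1})\subseteq G\setminus\{e\}$ is an equality under either of the following conditions: (a) the order of $y'y^{ -1}$ is greater than $|Y|$ for all $y,y'\in Y$ with $y\neq y'$; (b) $|Y|$ is not divisible by the order of any nontrivial finite subgroup of $G$.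
   Context: For subsets $A,B$ of a group $G$, $A\cdot B=\{ab:a\in A,b\in B\}$, $A^{ -1}=\{a^{ -1}:a\in A\}$, and $g\cdot A=\{ga: a\in A\}$. A right coset of $L$ is a set $Lg$; $e$ denotes the identity of $G$. -}

module Defs where

open import Level using (Level; _⊔_)
open import Algebra.Bundles using (Group)
open import Data.Nat using (ℕ; zero; suc; _≤_; _<_)
open import Data.Nat.Divisibility using (_∣_)
open import Data.Fin using (Fin)
open import Data.Product using (Σ; ∃; _×_; _,_)
open import Relation.Binary.PropositionalEquality using (_≡_)
open import Relation.Nullary using (¬_)
open import Relation.Unary using (Pred; _∈_; _∉_; _⊆_; _≐_)

module GroupDefs {c ℓ : Level} (G : Group c ℓ) where

  open Group G

  SubsetG : Set (Level.suc (c ⊔ ℓ))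
  SubsetG = Pred Carrier (c ⊔ ℓ)

  Respects≈ : SubsetG → Set (c ⊔ ℓ)
  Respects≈ A = ∀ {a b} → a ≈ b → A a → A b

  _·_ : SubsetG → SubsetG → SubsetG
  (A · B) x = Σ Carrier λ a → Σ Carrier λ b → A a × B b × x ≈ a ∙ b

  _⁻¹ˢ : SubsetG → SubsetG
  (A ⁻¹ˢ) x = Σ Carrier λ a → A a × x ≈ a ⁻¹

  _•_ : Carrier → SubsetG → SubsetG
  (g • A) x = Σ Carrier λ a → A a × x ≈ g ∙ a

  rightCoset : SubsetG → Carrier → SubsetG
  rightCoset L g x = Σ Carrier λ l → L l × x ≈ l ∙ g

  record Subgroup : Set (Level.suc (c ⊔ ℓ)) where
    field
      pred    : SubsetG
      resp    : Respects≈ pred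
      ε-mem   : ε ∈ pred
      ∙-mem   : ∀ {a b} → a ∈ pred → b ∈ pred → (a ∙ b) ∈ pred
      ⁻¹-mem  : ∀ {a} → a ∈ pred → (a ⁻¹) ∈ pred

  open Subgroup public

  UnionOfRightCosets : SubsetG → Subgroup → Set (Level.suc (c ⊔ ℓ))
  UnionOfRightCosets A H =
    Σ SubsetG λ T → A ≐ (λ x → Σ Carrier λ t → T t × rightCoset (pred H) t x)

  ProperlyContains : Subgroup → Subgroup → Set (c ⊔ ℓ)
  ProperlyContains K H = (pred H ⊆ pred K) × (Σ Carrier λ k → k ∈ pred K × k ∉ pred H)

  HasCard : SubsetG → ℕ → Set (c ⊔ ℓ)
  HasCard A n = Σ (Fin n → Carrier) λ f →
      (∀ i → f i ∈ A)
    × (∀ i j → f i ≈ f j → i ≡ j)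
    × (∀ {a} → a ∈ A → Σ (Fin n) λ i → a ≈ f i)

  _^_ : Carrier → ℕ → Carrier
  g ^ zero  = ε
  g ^ suc n = g ∙ (g ^ n)

  HasOrder : Carrier → ℕ → Set ℓ
  HasOrder g k = (0 < k) × (g ^ k ≈ ε) × (∀ j → 0 < j → j < k → ¬ (g ^ j ≈ ε))

  -- the order of g (possibly infinite) is greater than n
  OrderGreaterThan : Carrier → ℕ → Set ℓ
  OrderGreaterThan g n = ¬ (Σ ℕ λ k → HasOrder g k × k ≤ n)

  ConditionA : SubsetG → ℕ → Set (c ⊔ ℓ)
  ConditionA Y n = ∀ y y' → y ∈ Y → y' ∈ Y → ¬ (y ≈ y') → OrderGreaterThan (y' ∙ y ⁻¹) n

  ConditionB : ℕ → Set (Level.suc (c ⊔ ℓ))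
  ConditionB n = (H : Subgroup) → (m : ℕ) → HasCard (pred H) m → ¬ (m ≡ 1) → ¬ (m ∣ n)

module Submission where

-- Let G = X ⊔ Y be a partition of a group and U = X·Y⁻¹ ∪ Y·X⁻¹.  Everything rests
-- on one observation: g ∉ U exactly when left translation by g maps X into X and Y
-- into Y.  So the complement S of U is the common stabiliser of X and Y, a subgroup;
-- a subgroup H has Y (equivalently X) as a union of right cosets iff H stabilises Y,
-- iff H ⊆ S.  Thus S is the largest such subgroup, L ⊆ S gives U ⊆ G ∖ L, and each
-- of (1)-(5) says that S is strictly larger than L.
--
-- For the finite part, a nontrivial g ∈ S acts freely on Y; along an enumeration of Y
-- it becomes a self-map σ of Fin |Y| whose orbits all have the order k of g.
-- Pigeonhole gives k ≤ |Y|, contradicting (a); orbit counting gives k ∣ |Y| for the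
-- k-element subgroup ⟨g⟩ ≠ 1, contradicting (b).  Excluded middle then yields g ∈ U.

open import Defs
open import Level using (_⊔_; Lift; lift)
open import Algebra.Bundles using (Group)
open import Axiom.ExcludedMiddle using (ExcludedMiddle)
open import Data.Empty using (⊥-elim)
open import Data.Fin using (Fin; toℕ; fromℕ; fromℕ<; inject₁) renaming (zero to fzero; suc to fsuc)
open import Data.Fin.Properties using (toℕ-fromℕ; toℕ-fromℕ<; toℕ-inject₁; toℕ<n; <-cmp; pigeonhole) renaming (_≟_ to _≟ᶠ_)
open import Data.List using (List; []; _∷_; length; filter; tabulate; allFin; _++_)
open import Data.List.Properties using (length-tabulate; length-++)
open import Data.List.Membership.Propositional using () renaming (_∈_ to _∈ₗ_)
open import Data.List.Membership.Propositional.Properties using (∈-filter⁺; ∈-filter⁻; ∈-tabulate⁺; ∈-tabulate⁻; ∈-allFin; ∈-∃++; ∈-++⁻; ∈-++⁺ˡ; ∈-++⁺ʳ)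
open import Data.List.Relation.Unary.All as All using ()
open import Data.List.Relation.Unary.AllPairs using (_∷_)
open import Data.List.Relation.Unary.Any using (here; there)
open import Data.List.Relation.Unary.Unique.Propositional using (Unique)
open import Data.List.Relation.Unary.Unique.Propositional.Properties using (filter⁺; tabulate⁺; allFin⁺)
open import Data.Nat using (ℕ; zero; suc; _+_; _*_; _∸_; _≤_; _<_; z≤n; s≤s; NonZero; _%_; _/_)
open import Data.Nat.Properties using (+-comm; +-suc; *-suc; ≤-antisym; ≤-trans; ≤-<-trans; ≤-pred; m∸n≤m; m∸n+n≡m; m<n⇒0<n∸m; m≤n+m; n<1+n; <⇒≤; module ≤-Reasoning)
open import Data.Nat.DivMod using (m≡m%n+[m/n]*n; m%n<n)
open import Data.Nat.Divisibility using (_∣_; ∣-refl; _∣0; ∣m∣n⇒∣m+n)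
open import Data.Nat.GeneralisedArithmetic using (fold; fold-+)
open import Data.Nat.Induction using (<-rec)
open import Data.Product using (Σ; _×_; _,_; proj₁; proj₂)
open import Data.Sum as Sum using (_⊎_; inj₁; inj₂)
open import Function using (_∘_)
open import Function.Bundles using (_⇔_; mk⇔)
open import Relation.Binary using (tri<; tri≈; tri>)
open import Relation.Binary.PropositionalEquality as ≡ using (_≡_; _≢_)
open import Relation.Nullary using (¬_; Dec; yes; no)
import Relation.Nullary.Decidable as Dec
open import Relation.Nullary.Decidable using (decidable-stable)
open import Relation.Unary using (Pred; Decidable; _∈_; _∉_; _⊆_; _≐_; _∪_; ∁)
open import Relation.Unary.Properties using (∁?)

leastWitness : ∀ {p} {P : ℕ → Set p} → Decidable P → ∀ {n} → P n →
               Σ ℕ λ k → P k × k ≤ n × (∀ {j} → j < k → ¬ P j)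
leastWitness P? {n} Pn with P? 0
... | yes P0 = 0 , P0 , z≤n , λ ()
leastWitness P? {zero}  Pn | no ¬P0 = ⊥-elim (¬P0 Pn)
leastWitness P? {suc n} Pn | no ¬P0 with leastWitness (λ j → P? (suc j)) Pn
... | k , Pk , k≤n , below = suc k , Pk , s≤s k≤n , λ { {zero} _ → ¬P0 ; {suc j} (s≤s j<k) → below j<k }

length-filter-split : ∀ {a p} {A : Set a} {P : Pred A p} (P? : Decidable P) xs →
                      length xs ≡ length (filter P? xs) + length (filter (∁? P?) xs)
length-filter-split P? [] = ≡.refl
length-filter-split P? (x ∷ xs) with P? x
... | yes _ = ≡.cong suc (length-filter-split P? xs)
... | no  _ = ≡.trans (≡.cong suc (length-filter-split P? xs)) (≡.sym (+-suc _ _))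

unique⊆⇒length≤ : ∀ {a} {A : Set a} {xs ys : List A} → Unique xs →
                  (∀ {z} → z ∈ₗ xs → z ∈ₗ ys) → length xs ≤ length ys
unique⊆⇒length≤ {xs = []} _ _ = z≤n
unique⊆⇒length≤ {xs = x ∷ xs} (x∉xs ∷ xs-unique) xs⊆ys with ∈-∃++ (xs⊆ys (here ≡.refl))
... | us , vs , ≡.refl = begin
  suc (length xs)              ≤⟨ s≤s (unique⊆⇒length≤ xs-unique xs⊆us++vs) ⟩
  suc (length (us ++ vs))      ≡⟨ ≡.cong suc (length-++ us) ⟩
  suc (length us + length vs)  ≡⟨ +-suc (length us) (length vs) ⟨
  length us + length (x ∷ vs)  ≡⟨ length-++ us ⟨
  length (us ++ x ∷ vs)        ∎
  where
  open ≤-Reasoning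
  -- the elements of xs differ from x, so they avoid the removed occurrence of x
  xs⊆us++vs : ∀ {z} → z ∈ₗ xs → z ∈ₗ us ++ vs
  xs⊆us++vs z∈xs with ∈-++⁻ us (xs⊆ys (there z∈xs))
  ... | inj₁ z∈us          = ∈-++⁺ˡ z∈us
  ... | inj₂ (here ≡.refl) = ⊥-elim (All.lookup x∉xs z∈xs ≡.refl)
  ... | inj₂ (there z∈vs)  = ∈-++⁺ʳ us z∈vs

unique-same-elements⇒length≡ : ∀ {a} {A : Set a} {xs ys : List A} → Unique xs → Unique ys →
  (∀ {z} → z ∈ₗ xs → z ∈ₗ ys) → (∀ {z} → z ∈ₗ ys → z ∈ₗ xs) → length xs ≡ length ys
unique-same-elements⇒length≡ xs-unique ys-unique xs⊆ys ys⊆xs =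
  ≤-antisym (unique⊆⇒length≤ xs-unique xs⊆ys) (unique⊆⇒length≤ ys-unique ys⊆xs)

-- A self-map σ of Fin n on which the cyclic group of order K = suc k acts freely:
-- σ^K is the identity and no σ^j with 0 < j < K has a fixed point.  Every orbit
-- then has exactly K elements, so K divides n.  Here σ^j a is written fold a σ j.
module FreeCyclicAction {n : ℕ} (σ : Fin n → Fin n) (k : ℕ)
  (period : ∀ a → fold a σ (suc k) ≡ a)
  (free : ∀ a j → 0 < j → j < suc k → fold a σ j ≢ a) where

  open ≡ using (refl; sym; trans; cong)
  open import Data.List.Membership.DecPropositional (_≟ᶠ_ {n}) using (_∈?_)
  open ≡.≡-Reasoning

  K : ℕ
  K = suc k

  unwind : ∀ a → fold (σ a) σ k ≡ a
  unwind a = begin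
    fold (σ a) σ k      ≡⟨ fold-+ a σ k ⟨
    fold a σ (k + 1)    ≡⟨ cong (fold a σ) (+-comm k 1) ⟩
    fold a σ K          ≡⟨ period a ⟩
    a                   ∎

  σ-injective : ∀ {a b} → σ a ≡ σ b → a ≡ b
  σ-injective {a} {b} σa≡σb = trans (sym (unwind a)) (trans (cong (λ x → fold x σ k) σa≡σb) (unwind b))

  iterates-distinct : ∀ a {i j} → i < j → j < K → fold a σ i ≢ fold a σ j
  iterates-distinct a {i} {j} i<j j<K σⁱa≡σʲa = free (fold a σ i) (j ∸ i) (m<n⇒0<n∸m i<j)
      (≤-<-trans (m∸n≤m j i) j<K) (begin
    fold (fold a σ i) σ (j ∸ i)  ≡⟨ fold-+ a σ (j ∸ i) ⟨
    fold a σ (j ∸ i + i)         ≡⟨ cong (fold a σ) (m∸n+n≡m (<⇒≤ i<j)) ⟩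
    fold a σ j                   ≡⟨ σⁱa≡σʲa ⟨
    fold a σ i                   ∎)

  orbit : Fin n → List (Fin n)
  orbit a = tabulate {n = K} (λ j → fold a σ (toℕ j))

  orbit-unique : ∀ a → Unique (orbit a)
  orbit-unique a = tabulate⁺ injective
    where
    injective : ∀ {i j : Fin K} → fold a σ (toℕ i) ≡ fold a σ (toℕ j) → i ≡ j
    injective {i} {j} eq with <-cmp i j
    ... | tri< i<j _ _ = ⊥-elim (iterates-distinct a i<j (toℕ<n j) eq)
    ... | tri≈ _ i≡j _ = i≡j
    ... | tri> _ _ j<i = ⊥-elim (iterates-distinct a j<i (toℕ<n i) (sym eq))

  ∈-orbit : ∀ a (j : Fin K) {z} → z ≡ fold a σ (toℕ j) → z ∈ₗ orbit a
  ∈-orbit a j refl = ∈-tabulate⁺ {f = λ j → fold a σ (toℕ j)} j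

  orbit-closed⁻ : ∀ a {z} → σ z ∈ₗ orbit a → z ∈ₗ orbit a
  orbit-closed⁻ a {z} σz∈orbit with ∈-tabulate⁻ {f = λ j → fold a σ (toℕ j)} σz∈orbit
  ... | fzero , σz≡a = ∈-orbit a (fromℕ k) (begin
    z                    ≡⟨ unwind z ⟨
    fold (σ z) σ k       ≡⟨ cong (λ x → fold x σ k) σz≡a ⟩
    fold a σ k           ≡⟨ cong (fold a σ) (toℕ-fromℕ k) ⟨
    fold a σ (toℕ (fromℕ k)) ∎)
  ... | fsuc j , σz≡σσʲa = ∈-orbit a (inject₁ j)
    (trans (σ-injective σz≡σσʲa) (cong (fold a σ) (sym (toℕ-inject₁ j))))

  Closed : List (Fin n) → Set
  Closed l = ∀ {z} → z ∈ₗ l → σ z ∈ₗ l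

  orbit⊆closed : ∀ {l a} → Closed l → a ∈ₗ l → ∀ {z} → z ∈ₗ orbit a → z ∈ₗ l
  orbit⊆closed {l} {a} closed a∈l z∈orbit with ∈-tabulate⁻ {f = λ j → fold a σ (toℕ j)} z∈orbit
  ... | j , refl = iterates∈ (toℕ j)
    where
    iterates∈ : ∀ j → fold a σ j ∈ₗ l
    iterates∈ zero    = a∈l
    iterates∈ (suc j) = closed (iterates∈ j)

  -- A duplicate-free σ-closed list is a disjoint union of orbits, so K divides its length:
  -- remove the orbit of its head and recurse on the rest.
  K∣length : ∀ m (l : List (Fin n)) → length l ≡ m → Unique l → Closed l → K ∣ m
  K∣length = <-rec _ step
    where
    step : ∀ m → (∀ {m'} → m' < m → ∀ l → length l ≡ m' → Unique l → Closed l → K ∣ m') →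
           ∀ l → length l ≡ m → Unique l → Closed l → K ∣ m
    step m rec [] refl _ _ = K ∣0
    step m rec l@(a ∷ _) refl l-unique l-closed =
      ≡.subst (K ∣_) (sym length-split) (∣m∣n⇒∣m+n ∣-refl rest-divisible)
      where
      inOrbit? : Decidable (_∈ₗ orbit a)
      inOrbit? z = z ∈? orbit a

      rest : List (Fin n)
      rest = filter (∁? inOrbit?) l

      orbit-length : length (filter inOrbit? l) ≡ K
      orbit-length = trans
        (unique-same-elements⇒length≡ (filter⁺ inOrbit? l-unique) (orbit-unique a)
          (λ z∈ → proj₂ (∈-filter⁻ inOrbit? {xs = l} z∈))
          (λ z∈orbit → ∈-filter⁺ inOrbit? (orbit⊆closed l-closed (here refl) z∈orbit) z∈orbit))
        (length-tabulate (λ (j : Fin K) → fold a σ (toℕ j)))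

      length-split : length l ≡ K + length rest
      length-split = trans (length-filter-split inOrbit? l) (cong (_+ length rest) orbit-length)

      rest-closed : Closed rest
      rest-closed z∈rest with ∈-filter⁻ (∁? inOrbit?) {xs = l} z∈rest
      ... | z∈l , z∉orbit = ∈-filter⁺ (∁? inOrbit?) (l-closed z∈l) (z∉orbit ∘ orbit-closed⁻ a)

      rest-shorter : length rest < length l
      rest-shorter = ≡.subst (length rest <_) (sym length-split) (s≤s (m≤n+m (length rest) k))

      rest-divisible : K ∣ length rest
      rest-divisible = rec rest-shorter rest refl (filter⁺ (∁? inOrbit?) l-unique) rest-closed

  K∣n : K ∣ n
  K∣n = K∣length n (allFin n) (length-tabulate (λ i → i)) (allFin⁺ n) (λ {z} _ → ∈-allFin (σ z))

module GroupTheory {c ℓ} (G : Group c ℓ) where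
  open Group G
  open GroupDefs G
  open import Algebra.Properties.Group G using (∙-cancelʳ; identityˡ-unique; inverseʳ-unique)
  open import Relation.Binary.Reasoning.Setoid setoid

  [xy]y⁻¹≈x : ∀ x y → (x ∙ y) ∙ y ⁻¹ ≈ x
  [xy]y⁻¹≈x x y = trans (assoc x y (y ⁻¹)) (trans (∙-congˡ (inverseʳ y)) (identityʳ x))

  [xy⁻¹]y≈x : ∀ x y → (x ∙ y ⁻¹) ∙ y ≈ x
  [xy⁻¹]y≈x x y = trans (assoc x (y ⁻¹) y) (trans (∙-congˡ (inverseˡ y)) (identityʳ x))

  x⁻¹[xy]≈y : ∀ x y → x ⁻¹ ∙ (x ∙ y) ≈ y
  x⁻¹[xy]≈y x y = trans (sym (assoc (x ⁻¹) x y)) (trans (∙-congʳ (inverseˡ x)) (identityˡ y))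

  x[x⁻¹y]≈y : ∀ x y → x ∙ (x ⁻¹ ∙ y) ≈ y
  x[x⁻¹y]≈y x y = trans (sym (assoc x (x ⁻¹) y)) (trans (∙-congʳ (inverseʳ x)) (identityˡ y))

  ^-cong : ∀ {x y} j → x ≈ y → x ^ j ≈ y ^ j
  ^-cong zero    x≈y = refl
  ^-cong (suc j) x≈y = ∙-cong x≈y (^-cong j x≈y)

  ^-+ : ∀ x i j → x ^ (i + j) ≈ x ^ i ∙ x ^ j
  ^-+ x zero    j = sym (identityˡ (x ^ j))
  ^-+ x (suc i) j = trans (∙-congˡ (^-+ x i j)) (sym (assoc x (x ^ i) (x ^ j)))

  ^-multiple : ∀ {x K} → x ^ K ≈ ε → ∀ q → x ^ (q * K) ≈ ε
  ^-multiple x^K≈ε zero    = refl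
  ^-multiple {x} {K} x^K≈ε (suc q) = begin
    x ^ (K + q * K)      ≈⟨ ^-+ x K (q * K) ⟩
    x ^ K ∙ x ^ (q * K)  ≈⟨ ∙-cong x^K≈ε (^-multiple x^K≈ε q) ⟩
    ε ∙ ε                ≈⟨ identityˡ ε ⟩
    ε                    ∎

  ^-mod : ∀ {x K} .{{_ : NonZero K}} → x ^ K ≈ ε → ∀ i → x ^ i ≈ x ^ (i % K)
  ^-mod {x} {K} x^K≈ε i = begin
    x ^ i                              ≡⟨ ≡.cong (x ^_) (m≡m%n+[m/n]*n i K) ⟩
    x ^ (i % K + (i / K) * K)          ≈⟨ ^-+ x (i % K) ((i / K) * K) ⟩
    x ^ (i % K) ∙ x ^ ((i / K) * K)    ≈⟨ ∙-congˡ (^-multiple x^K≈ε (i / K)) ⟩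
    x ^ (i % K) ∙ ε                    ≈⟨ identityʳ _ ⟩
    x ^ (i % K)                        ∎

  ^-gap : ∀ x {i j} → i ≤ j → x ^ i ≈ x ^ j → x ^ (j ∸ i) ≈ ε
  ^-gap x {i} {j} i≤j x^i≈x^j = identityˡ-unique (x ^ (j ∸ i)) (x ^ i) (begin
    x ^ (j ∸ i) ∙ x ^ i   ≈⟨ ^-+ x (j ∸ i) i ⟨
    x ^ (j ∸ i + i)       ≡⟨ ≡.cong (x ^_) (m∸n+n≡m i≤j) ⟩
    x ^ j                 ≈⟨ x^i≈x^j ⟨
    x ^ i                 ∎)

  HasOrder-cong : ∀ {x y k} → x ≈ y → HasOrder x k → HasOrder y k
  HasOrder-cong {k = k} x≈y (0<k , x^k≈ε , minimal) =
    0<k , trans (^-cong k (sym x≈y)) x^k≈ε , λ j 0<j j<k y^j≈ε → minimal j 0<j j<k (trans (^-cong j x≈y) y^j≈ε)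

  order-1⇒ε : ∀ {x} → HasOrder x 1 → x ≈ ε
  order-1⇒ε {x} (_ , x¹≈ε , _) = trans (sym (identityʳ x)) x¹≈ε

  order-exists : ∀ {x} → (∀ j → Dec (x ^ j ≈ ε)) → ∀ {d} → 0 < d → x ^ d ≈ ε →
                 Σ ℕ λ k → HasOrder x k × k ≤ d
  order-exists {x} x^?≈ε {suc d} _ x^d≈ε with leastWitness (λ j → x^?≈ε (suc j)) x^d≈ε
  ... | m , x^m≈ε , m≤d , below = suc m , (s≤s z≤n , x^m≈ε , minimal) , s≤s m≤d
    where
    minimal : ∀ j → 0 < j → j < suc m → ¬ x ^ j ≈ ε
    minimal (suc j) _ (s≤s j<m) = below j<m

  cyclicSubgroup : ∀ {x K} → HasOrder x K → Σ Subgroup λ H → HasCard (pred H) K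
  cyclicSubgroup {x} {suc k} (_ , x^K≈ε , minimal) =
    ⟨x⟩ , (λ i → x ^ toℕ i) , (λ i → lift (toℕ i , refl)) , injective , onto
    where
    K = suc k

    -- the inverse of x ^ i is again a power, since i + i * k = i * K
    power⁻¹ : ∀ i → (x ^ i) ⁻¹ ≈ x ^ (i * k)
    power⁻¹ i = sym (inverseʳ-unique (x ^ i) (x ^ (i * k)) (begin
      x ^ i ∙ x ^ (i * k)   ≈⟨ ^-+ x i (i * k) ⟨
      x ^ (i + i * k)       ≡⟨ ≡.cong (x ^_) (*-suc i k) ⟨
      x ^ (i * K)           ≈⟨ ^-multiple x^K≈ε i ⟩
      ε                     ∎))

    ⟨x⟩ : Subgroup
    ⟨x⟩ = record
      { pred   = λ h → Lift c (Σ ℕ λ i → h ≈ x ^ i)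
      ; resp   = λ { h≈h' (lift (i , h≈xⁱ)) → lift (i , trans (sym h≈h') h≈xⁱ) }
      ; ε-mem  = lift (0 , refl)
      ; ∙-mem  = λ { (lift (i , g≈xⁱ)) (lift (j , h≈xʲ)) →
                     lift (i + j , trans (∙-cong g≈xⁱ h≈xʲ) (sym (^-+ x i j))) }
      ; ⁻¹-mem = λ { (lift (i , h≈xⁱ)) → lift (i * k , trans (⁻¹-cong h≈xⁱ) (power⁻¹ i)) }
      }

    distinct : ∀ {i j : Fin K} → toℕ i < toℕ j → ¬ x ^ toℕ i ≈ x ^ toℕ j
    distinct {i} {j} i<j x^i≈x^j = minimal (toℕ j ∸ toℕ i) (m<n⇒0<n∸m i<j)
      (≤-<-trans (m∸n≤m (toℕ j) (toℕ i)) (toℕ<n j)) (^-gap x (<⇒≤ i<j) x^i≈x^j)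

    injective : ∀ i j → x ^ toℕ i ≈ x ^ toℕ j → i ≡ j
    injective i j x^i≈x^j with <-cmp i j
    ... | tri< i<j _ _ = ⊥-elim (distinct i<j x^i≈x^j)
    ... | tri≈ _ i≡j _ = i≡j
    ... | tri> _ _ j<i = ⊥-elim (distinct j<i (sym x^i≈x^j))

    onto : ∀ {h} → h ∈ pred ⟨x⟩ → Σ (Fin K) λ r → h ≈ x ^ toℕ r
    onto (lift (i , h≈xⁱ)) = fromℕ< (m%n<n i K) ,
      trans h≈xⁱ (trans (^-mod x^K≈ε i) (reflexive (≡.cong (x ^_) (≡.sym (toℕ-fromℕ< (m%n<n i K))))))

  Stable : SubsetG → Carrier → Set (c ⊔ ℓ)
  Stable A g = ∀ {a} → a ∈ A → (g ∙ a) ∈ A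

  stable-ε : ∀ {A} → Respects≈ A → Stable A ε
  stable-ε rA a∈A = rA (sym (identityˡ _)) a∈A

  stable-∙ : ∀ {A g h} → Respects≈ A → Stable A g → Stable A h → Stable A (g ∙ h)
  stable-∙ {g = g} {h} rA g-stable h-stable {a} a∈A = rA (sym (assoc g h a)) (g-stable (h-stable a∈A))

  -- A union of right cosets H t is stable under every h ∈ H, since h (l t) = (h l) t.
  cosetUnion⇒stable : ∀ A H → UnionOfRightCosets A H → ∀ {h} → h ∈ pred H → Stable A h
  cosetUnion⇒stable A H (T , A⊆HT , HT⊆A) {h} h∈H a∈A with A⊆HT a∈A
  ... | t , t∈T , l , l∈H , a≈lt =
    HT⊆A (t , t∈T , h ∙ l , ∙-mem H h∈H l∈H , trans (∙-congˡ a≈lt) (sym (assoc h l t)))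

  -- Conversely, a set stable under all of H is the union of the cosets H a, a ∈ A.
  stable⇒cosetUnion : ∀ A H → Respects≈ A → (∀ {h} → h ∈ pred H → Stable A h) → UnionOfRightCosets A H
  stable⇒cosetUnion A H rA H-stable = A , A⊆HA , HA⊆A
    where
    A⊆HA : ∀ {a} → a ∈ A → Σ Carrier λ t → t ∈ A × rightCoset (pred H) t a
    A⊆HA {a} a∈A = a , a∈A , ε , ε-mem H , sym (identityˡ a)
    HA⊆A : ∀ {a} → (Σ Carrier λ t → t ∈ A × rightCoset (pred H) t a) → a ∈ A
    HA⊆A (t , t∈A , l , l∈H , a≈lt) = rA (sym a≈lt) (H-stable l∈H t∈A)

  -- One half of the difference set of a partition G = A ⊔ B: the set A · B⁻¹
  -- consists exactly of the elements that move some point of B into A.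
  module DifferenceHalf (A B : SubsetG) (rA : Respects≈ A) (rB : Respects≈ B)
    (disjoint : ∀ g → g ∈ A → g ∉ B) (cover : ∀ g → (g ∈ A) ⊎ (g ∈ B)) where

    ∉AB⁻¹⇒stable : ∀ {g} → g ∉ (A · (B ⁻¹ˢ)) → Stable B g
    ∉AB⁻¹⇒stable {g} g∉AB⁻¹ {b} b∈B with cover (g ∙ b)
    ... | inj₂ gb∈B = gb∈B
    ... | inj₁ gb∈A = ⊥-elim (g∉AB⁻¹ (g ∙ b , b ⁻¹ , gb∈A , (b , b∈B , refl) , sym ([xy]y⁻¹≈x g b)))

    stable⇒∉AB⁻¹ : ∀ {g} → Stable B g → g ∉ (A · (B ⁻¹ˢ))
    stable⇒∉AB⁻¹ {g} g-stable (a , c , a∈A , (b , b∈B , c≈b⁻¹) , g≈ac) =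
      disjoint a a∈A (rB gb≈a (g-stable b∈B))
      where
      gb≈a : g ∙ b ≈ a
      gb≈a = begin
        g ∙ b          ≈⟨ ∙-congʳ (trans g≈ac (∙-congˡ c≈b⁻¹)) ⟩
        (a ∙ b ⁻¹) ∙ b ≈⟨ [xy⁻¹]y≈x a b ⟩
        a              ∎

    -- As A and B are complementary, g stabilises A iff g⁻¹ stabilises B.
    stable⇒inverse-stable : ∀ {g} → Stable A g → Stable B (g ⁻¹)
    stable⇒inverse-stable {g} g-stable {b} b∈B with cover (g ⁻¹ ∙ b)
    ... | inj₂ g⁻¹b∈B = g⁻¹b∈B
    ... | inj₁ g⁻¹b∈A = ⊥-elim (disjoint b (rA (x[x⁻¹y]≈y g b) (g-stable g⁻¹b∈A)) b∈B)

    inverse-stable⇒stable : ∀ {g} → Stable B (g ⁻¹) → Stable A g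
    inverse-stable⇒stable {g} g⁻¹-stable {a} a∈A with cover (g ∙ a)
    ... | inj₁ ga∈A = ga∈A
    ... | inj₂ ga∈B = ⊥-elim (disjoint a a∈A (rB (x⁻¹[xy]≈y g a) (g⁻¹-stable ga∈B)))

  module Partition (X Y : SubsetG) (rX : Respects≈ X) (rY : Respects≈ Y)
    (disjoint : ∀ g → g ∈ X → g ∉ Y) (cover : ∀ g → (g ∈ X) ⊎ (g ∈ Y)) where

    module XY = DifferenceHalf X Y rX rY disjoint cover
    module YX = DifferenceHalf Y X rY rX (λ g g∈Y g∈X → disjoint g g∈X g∈Y) (Sum.swap ∘ cover)

    U : SubsetG
    U = (X · (Y ⁻¹ˢ)) ∪ (Y · (X ⁻¹ˢ))

    ∉U⇒stableX : ∀ {g} → g ∉ U → Stable X g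
    ∉U⇒stableX g∉U = YX.∉AB⁻¹⇒stable (g∉U ∘ inj₂)

    ∉U⇒stableY : ∀ {g} → g ∉ U → Stable Y g
    ∉U⇒stableY g∉U = XY.∉AB⁻¹⇒stable (g∉U ∘ inj₁)

    stable⇒∉U : ∀ {g} → Stable X g → Stable Y g → g ∉ U
    stable⇒∉U X-stable Y-stable (inj₁ g∈XY⁻¹) = XY.stable⇒∉AB⁻¹ Y-stable g∈XY⁻¹
    stable⇒∉U X-stable Y-stable (inj₂ g∈YX⁻¹) = YX.stable⇒∉AB⁻¹ X-stable g∈YX⁻¹

    Y-stable±⇒∉U : ∀ {g} → Stable Y g → Stable Y (g ⁻¹) → g ∉ U
    Y-stable±⇒∉U g-stable g⁻¹-stable = stable⇒∉U (XY.inverse-stable⇒stable g⁻¹-stable) g-stable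

    X-stable±⇒∉U : ∀ {g} → Stable X g → Stable X (g ⁻¹) → g ∉ U
    X-stable±⇒∉U g-stable g⁻¹-stable = stable⇒∉U g-stable (YX.inverse-stable⇒stable g⁻¹-stable)

    U-resp : ∀ {g h} → g ≈ h → h ∈ U → g ∈ U
    U-resp g≈h (inj₁ (a , b , a∈ , b∈ , h≈ab)) = inj₁ (a , b , a∈ , b∈ , trans g≈h h≈ab)
    U-resp g≈h (inj₂ (a , b , a∈ , b∈ , h≈ab)) = inj₂ (a , b , a∈ , b∈ , trans g≈h h≈ab)

    S : Subgroup
    S = record
      { pred   = ∁ U
      ; resp   = λ g≈h g∉U h∈U → g∉U (U-resp g≈h h∈U)
      ; ε-mem  = stable⇒∉U (stable-ε rX) (stable-ε rY)
      ; ∙-mem  = λ g∉U h∉U → stable⇒∉U (stable-∙ rX (∉U⇒stableX g∉U) (∉U⇒stableX h∉U))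
                                       (stable-∙ rY (∉U⇒stableY g∉U) (∉U⇒stableY h∉U))
      ; ⁻¹-mem = λ g∉U → stable⇒∉U (YX.stable⇒inverse-stable (∉U⇒stableY g∉U))
                                   (XY.stable⇒inverse-stable (∉U⇒stableX g∉U))
      }

    Y-cosetsOf-S : UnionOfRightCosets Y S
    Y-cosetsOf-S = stable⇒cosetUnion Y S rY ∉U⇒stableY

    X-cosetsOf-S : UnionOfRightCosets X S
    X-cosetsOf-S = stable⇒cosetUnion X S rX ∉U⇒stableX

    Y-maximal : ∀ H → UnionOfRightCosets Y H → pred H ⊆ pred S
    Y-maximal H Y=HT h∈H =
      Y-stable±⇒∉U (cosetUnion⇒stable Y H Y=HT h∈H) (cosetUnion⇒stable Y H Y=HT (⁻¹-mem H h∈H))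

    X-maximal : ∀ H → UnionOfRightCosets X H → pred H ⊆ pred S
    X-maximal H X=HT h∈H =
      X-stable±⇒∉U (cosetUnion⇒stable X H X=HT h∈H) (cosetUnion⇒stable X H X=HT (⁻¹-mem H h∈H))

    ∉U⇒translate-fixes-Y : ∀ {g} → g ∉ U → (g • Y) ≐ Y
    ∉U⇒translate-fixes-Y {g} g∉U =
        (λ { (a , a∈Y , z≈ga) → rY (sym z≈ga) (∉U⇒stableY g∉U a∈Y) })
      , (λ {z} z∈Y → g ⁻¹ ∙ z , ∉U⇒stableY (⁻¹-mem S g∉U) z∈Y , sym (x[x⁻¹y]≈y g z))

    translate-fixes-Y⇒∉U : ∀ {g} → (g • Y) ≐ Y → g ∉ U
    translate-fixes-Y⇒∉U {g} (gY⊆Y , Y⊆gY) = Y-stable±⇒∉U (λ {y} y∈Y → gY⊆Y (y , y∈Y , refl)) g⁻¹-stable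
      where
      g⁻¹-stable : Stable Y (g ⁻¹)
      g⁻¹-stable y∈Y with Y⊆gY y∈Y
      ... | a , a∈Y , y≈ga = rY (sym (trans (∙-congˡ y≈ga) (x⁻¹[xy]≈y g a))) a∈Y

    -- Left translation by a Y-stabilising g, read through an enumeration f of a finite Y,
    -- is a self-map σ of the indices with f (σ^j i) ≈ g ^ j ∙ f i.
    module Translation {n} (f : Fin n → Carrier) (f∈Y : ∀ i → f i ∈ Y)
      (f-injective : ∀ i j → f i ≈ f j → i ≡ j) (f-onto : ∀ {a} → a ∈ Y → Σ (Fin n) λ i → a ≈ f i)
      {g} (g-stable : Stable Y g) where

      σ : Fin n → Fin n
      σ i = proj₁ (f-onto (g-stable (f∈Y i)))

      iterate-spec : ∀ j i → f (fold i σ j) ≈ g ^ j ∙ f i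
      iterate-spec zero    i = sym (identityˡ (f i))
      iterate-spec (suc j) i = begin
        f (σ (fold i σ j))       ≈⟨ proj₂ (f-onto (g-stable (f∈Y (fold i σ j)))) ⟨
        g ∙ f (fold i σ j)       ≈⟨ ∙-congˡ (iterate-spec j i) ⟩
        g ∙ (g ^ j ∙ f i)        ≈⟨ assoc g (g ^ j) (f i) ⟨
        g ^ suc j ∙ f i          ∎

      fixed⇒ε : ∀ {i} j → fold i σ j ≡ i → g ^ j ≈ ε
      fixed⇒ε {i} j σʲi≡i =
        identityˡ-unique (g ^ j) (f i) (trans (sym (iterate-spec j i)) (reflexive (≡.cong f σʲi≡i)))

      ε⇒fixed : ∀ {i} j → g ^ j ≈ ε → fold i σ j ≡ i
      ε⇒fixed {i} j gʲ≈ε = f-injective _ _ (trans (iterate-spec j i) (trans (∙-congʳ gʲ≈ε) (identityˡ (f i))))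

      repeat⇒ε : ∀ {i a b} → a ≤ b → fold i σ a ≡ fold i σ b → g ^ (b ∸ a) ≈ ε
      repeat⇒ε {i} {a} {b} a≤b σᵃi≡σᵇi = ^-gap g a≤b (∙-cancelʳ (f i) (g ^ a) (g ^ b) (begin
        g ^ a ∙ f i       ≈⟨ iterate-spec a i ⟨
        f (fold i σ a)    ≡⟨ ≡.cong f σᵃi≡σᵇi ⟩
        f (fold i σ b)    ≈⟨ iterate-spec b i ⟩
        g ^ b ∙ f i       ∎))

      -- whether g ^ j ≈ ε is decided by comparing indices
      g^?≈ε : Fin n → ∀ j → Dec (g ^ j ≈ ε)
      g^?≈ε i j = Dec.map′ (fixed⇒ε j) (ε⇒fixed j) (fold i σ j ≟ᶠ i)

      -- By pigeonhole among the n + 1 points σ^j i₀ (j ≤ n), g has an order k ≤ n.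
      order≤n : Fin n → Σ ℕ λ k → HasOrder g k × k ≤ n
      order≤n i₀ with pigeonhole (n<1+n n) (λ (j : Fin (suc n)) → fold i₀ σ (toℕ j))
      ... | a , b , a<b , σᵃi₀≡σᵇi₀
            with order-exists (g^?≈ε i₀) (m<n⇒0<n∸m a<b) (repeat⇒ε (<⇒≤ a<b) σᵃi₀≡σᵇi₀)
      ...   | k , order , k≤b∸a =
              k , order , ≤-trans k≤b∸a (≤-trans (m∸n≤m (toℕ b) (toℕ a)) (≤-pred (toℕ<n b)))

      -- ⟨g⟩ acts freely on Y, so its order divides |Y| = n.
      order∣n : ∀ {K} → HasOrder g K → K ∣ n
      order∣n {suc k} (_ , gᴷ≈ε , minimal) = FreeCyclicAction.K∣n σ k
        (λ a → ε⇒fixed (suc k) gᴷ≈ε) (λ a j 0<j j<K σʲa≡a → minimal j 0<j j<K (fixed⇒ε j σʲa≡a))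

    module NontrivialStabiliser {n} (f : Fin n → Carrier) (f∈Y : ∀ i → f i ∈ Y)
      (f-injective : ∀ i j → f i ≈ f j → i ≡ j) (f-onto : ∀ {a} → a ∈ Y → Σ (Fin n) λ i → a ≈ f i)
      {g} (g-stable : Stable Y g) (g≉ε : ¬ g ≈ ε) (i₀ : Fin n) where

      open Translation f f∈Y f-injective f-onto g-stable

      y≉gy : ∀ {y} → ¬ y ≈ g ∙ y
      y≉gy {y} y≈gy = g≉ε (identityˡ-unique g y (sym y≈gy))

      -- (a) fails for y = f i₀, y' = g y: then y' y⁻¹ ≈ g has order at most n
      violates-A : ¬ ConditionA Y n
      violates-A conditionA with order≤n i₀
      ... | k , order , k≤n = conditionA y (g ∙ y) (f∈Y i₀) (g-stable (f∈Y i₀)) y≉gy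
              (k , HasOrder-cong (sym ([xy]y⁻¹≈x g y)) order , k≤n)
        where y = f i₀

      order≢1 : ∀ {K} → HasOrder g K → K ≢ 1
      order≢1 order ≡.refl = g≉ε (order-1⇒ε order)

      -- (b) fails: the cyclic group ⟨g⟩ is nontrivial and its order divides n
      violates-B : ¬ ConditionB n
      violates-B conditionB with order≤n i₀
      ... | K , order , _ with cyclicSubgroup order
      ...   | H , H-card = conditionB H K H-card (order≢1 order) (order∣n order)

    U≐nontrivial : ExcludedMiddle (c ⊔ ℓ) → ∀ {n} → HasCard Y n → Σ Carrier (_∈ Y) →
                   ConditionA Y n ⊎ ConditionB n → U ≐ (λ g → ¬ g ≈ ε)
    U≐nontrivial lem {n} (f , f∈Y , f-injective , f-onto) (y₀ , y₀∈Y) condition =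
        (λ g∈U g≈ε → resp S (sym g≈ε) (ε-mem S) g∈U)
      , (λ g≉ε → decidable-stable lem (λ g∉U → violation g∉U g≉ε condition))
      where
      violation : ∀ {g} → g ∉ U → ¬ g ≈ ε → ¬ (ConditionA Y n ⊎ ConditionB n)
      violation g∉U g≉ε = Sum.[ violates-A , violates-B ]
        where open NontrivialStabiliser f f∈Y f-injective f-onto (∉U⇒stableY g∉U) g≉ε (proj₁ (f-onto y₀∈Y))

    module Conditions (L : Subgroup) (X=LT : UnionOfRightCosets X L) where

      L⊆S : pred L ⊆ pred S
      L⊆S = X-maximal L X=LT

      U⊆∁L : U ⊆ ∁ (pred L)
      U⊆∁L g∈U g∈L = L⊆S g∈L g∈U

      Proper : Set (c ⊔ ℓ)
      Proper = Σ Carrier (λ g → (g ∉ pred L) × (g ∉ U))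

      Partner : Carrier → Set (c ⊔ ℓ)
      Partner y = Σ Carrier (λ y' → (y' ∈ Y) × (y' ∉ rightCoset (pred L) y) × (((y' ∙ (y ⁻¹)) • Y) ≐ Y))

      Coarser : SubsetG → Set (Level.suc (c ⊔ ℓ))
      Coarser A = Σ Subgroup (λ K → ProperlyContains K L × UnionOfRightCosets A K)

      -- (1) ⇒ (2): for g ∈ S ∖ L take y' = g y
      proper⇒partner : Proper → ∀ y → y ∈ Y → Partner y
      proper⇒partner (g , g∉L , g∉U) y y∈Y =
        g ∙ y , ∉U⇒stableY g∉U y∈Y , gy∉Ly , ∉U⇒translate-fixes-Y (resp S (sym ([xy]y⁻¹≈x g y)) g∉U)
        where
        gy∉Ly : (g ∙ y) ∉ rightCoset (pred L) y
        gy∉Ly (l , l∈L , gy≈ly) = g∉L (resp L (sym (∙-cancelʳ y g l gy≈ly)) l∈L)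

      -- (3) ⇒ (1): g = y' y⁻¹ lies in S but not in L
      partner⇒proper : ∀ {y} → Partner y → Proper
      partner⇒proper {y} (y' , _ , y'∉Ly , y'y⁻¹Y≐Y) =
        y' ∙ y ⁻¹ , y'y⁻¹∉L , translate-fixes-Y⇒∉U y'y⁻¹Y≐Y
        where
        y'y⁻¹∉L : (y' ∙ y ⁻¹) ∉ pred L
        y'y⁻¹∉L y'y⁻¹∈L = y'∉Ly (y' ∙ y ⁻¹ , y'y⁻¹∈L , sym ([xy⁻¹]y≈x y' y))

      -- the coarser subgroup can always be taken to be S
      proper⇒coarser-Y : Proper → Coarser Y
      proper⇒coarser-Y (g , g∉L , g∉U) = S , (L⊆S , g , g∉U , g∉L) , Y-cosetsOf-S

      proper⇒coarser-X : Proper → Coarser X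
      proper⇒coarser-X (g , g∉L , g∉U) = S , (L⊆S , g , g∉U , g∉L) , X-cosetsOf-S

      -- a properly larger subgroup lies inside S, so S ∖ L is inhabited
      coarser-Y⇒proper : Coarser Y → Proper
      coarser-Y⇒proper (K , (_ , k , k∈K , k∉L) , Y=KT) = k , k∉L , Y-maximal K Y=KT k∈K

      coarser-X⇒proper : Coarser X → Proper
      coarser-X⇒proper (K , (_ , k , k∈K , k∉L) , X=KT) = k , k∉L , X-maximal K X=KT k∈K

proposition2p9 : ∀ {c ℓ} → ExcludedMiddle (c ⊔ ℓ) → (G : Group c ℓ) →
    let open Group G
        open GroupDefs G
    in (X Y : SubsetG) (L : Subgroup) →
    Respects≈ X → Respects≈ Y →
    -- X and Y nonempty
    Σ Carrier (λ x → x ∈ X) → Σ Carrier (λ y → y ∈ Y) →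
    -- X, Y disjoint with X ∪ Y = G
    (∀ g → g ∈ X → g ∉ Y) → (∀ g → (g ∈ X) ⊎ (g ∈ Y)) →
    UnionOfRightCosets X L →
    let U = (X · (Y ⁻¹ˢ)) ∪ (Y · (X ⁻¹ˢ))
        cond1 = Σ Carrier (λ g → (g ∉ pred L) × (g ∉ U))
        good = λ y → Σ Carrier (λ y' → (y' ∈ Y) × (y' ∉ rightCoset (pred L) y) × (((y' ∙ (y ⁻¹)) • Y) ≐ Y))
        cond2 = ∀ y → y ∈ Y → good y
        cond3 = Σ Carrier (λ y → (y ∈ Y) × good y)
        cond4 = Σ Subgroup (λ K → ProperlyContains K L × UnionOfRightCosets Y K)
        cond5 = Σ Subgroup (λ K → ProperlyContains K L × UnionOfRightCosets X K)
    in (U ⊆ ∁ (pred L))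
       × (cond1 ⇔ cond2) × (cond1 ⇔ cond3) × (cond1 ⇔ cond4) × (cond1 ⇔ cond5)
       × Σ Subgroup (λ S → (pred S ≐ ∁ U) × UnionOfRightCosets Y S
                           × (∀ H → UnionOfRightCosets Y H → pred H ⊆ pred S))
       × (∀ n → HasCard Y n → (ConditionA Y n ⊎ ConditionB n) → U ≐ (λ g → ¬ (g ≈ ε)))
proposition2p9 lem G X Y L rX rY _ (y₀ , y₀∈Y) disjoint cover X=LT =
    U⊆∁L
  , mk⇔ proper⇒partner (λ partners → partner⇒proper (partners y₀ y₀∈Y))
  , mk⇔ (λ proper → y₀ , y₀∈Y , proper⇒partner proper y₀ y₀∈Y) (λ (_ , _ , partner) → partner⇒proper partner)
  , mk⇔ proper⇒coarser-Y coarser-Y⇒proper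
  , mk⇔ proper⇒coarser-X coarser-X⇒proper
  , (S , ((λ g∉U → g∉U) , (λ g∉U → g∉U)) , Y-cosetsOf-S , Y-maximal)
  , λ n Y-card condition → U≐nontrivial lem Y-card (y₀ , y₀∈Y) condition
  where
  open GroupTheory G
  open Partition X Y rX rY disjoint cover
  open Conditions L X=LT
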